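{- Let $M$ be a matroid with ground set $\mathcal{A}$ and rank function $\mathrm{rk}$, let $k$ be a positive integer, and let $a\in\mathcal{A}$ be an element that is neither a loop nor a coloop of $M$. Then $$T^k_M((x_i)_1^k;(y_i)_1^k)=\sum_{j=0}^k sT^{k,j}_{M,a}((x_i)_1^k;(y_i)_1^k),$$ where $sT^{k,0}_{M,a}=T^k_{M/a}((x_i)_1^k;(y_i)_1^k)$, $sT^{k,k}_{M,a}=T^k_{M\backslash a}((x_i)_1^k;(y_i)_1^k)$, and for $j\in\{1,\dots,k-1\}$ $$sT^{k,j}_{M,a}=\sum_{\substack{S_1\subseteq S_2\subseteq\cdots\subseteq S_{k-j}\subseteq \mathcal{A}-a}} T^j_{M|_{S_1}}((x_i)_1^j;(y_i)_1^j)\prod_{i=1}^{k-j}(x_{i+j}-1)^{\mathrm{rk}(M/a)-\mathrm{rk}_{M/a}(S_i)}(y_{i+j}-1)^{|S_i|-\mathrm{rk}_{M/a}(S_i)}\prod_{i=1}^{j}(x_i-1)^{\mathrm{rk}(M)-\mathrm{rk}(S_1)}.$$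
   Context: For a matroid $N$ with ground set $E$ and rank function $\mathrm{rk}_N$, and a positive integer $k$, the $k$-th chain Tutte polynomial is $$T^k_N((x_i)_1^k;(y_i)_1^k)=\sum_{S_1\subseteq S_2\subseteq\cdots\subseteq S_k\subseteq E}\ \prod_{i=1}^k (x_i-1)^{\mathrm{rk}_N(E)-\mathrm{rk}_N(S_i)}(y_i-1)^{|S_i|-\mathrm{rk}_N(S_i)},$$ the sum running over all weakly increasing chains of $k$ subsets of $E$ (repetitions allowed). $\mathrm{rk}(N)=\mathrm{rk}_N(E)$. $M\backslash a$ is the deletion (ground set $\mathcal{A}-a$, rank function the restriction of $\mathrm{rk}$), $M/a$ the contraction (ground set $\mathcal{A}-a$, $\mathrm{rk}_{M/a}(X)=\mathrm{rk}(X\cup a)-\mathrm{rk}(a)$), and $M|_{S}$ the restriction of $M$ to $S$ (ground set $S$, rank function $\mathrm{rk}$ restricted to subsets of $S$). A loop is an element of rank $0$; a coloop is an element $a$ with $\mathrm{rk}(\mathcal{A}-a)=\mathrm{rk}(M)-1$. -}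

module Defs where

open import Level using (Level)
open import Data.Nat as ℕ using (ℕ; zero; suc; _∸_)
open import Data.Fin using (Fin; toℕ)
open import Data.Fin.Subset using (Subset; inside; outside; _⊆_; _∪_; _∩_; ∣_∣; ⊤; ⁅_⁆) renaming (_-_ to _∖_)
open import Data.Vec using (Vec; []; _∷_; _∷ʳ_; lookup; head)
open import Data.List using (List; []; _∷_; _++_; map; concatMap; foldr; upTo)
open import Relation.Nullary using (yes; no)
open import Algebra.Bundles using (CommutativeRing)

record Matroid (n : ℕ) : Set where
  field
    rk          : Subset n → ℕ
    rk-≤-card   : ∀ X → rk X ℕ.≤ ∣ X ∣
    rk-mono     : ∀ {X Y} → X ⊆ Y → rk X ℕ.≤ rk Y
    rk-submod   : ∀ X Y → rk (X ∪ Y) ℕ.+ rk (X ∩ Y) ℕ.≤ rk X ℕ.+ rk Y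

-- A matroid on a ground set E ⊆ Fin n, given by E and a rank function
-- (only its values on subsets of E matter).  Minors are of this form.
record Minor (n : ℕ) : Set where
  constructor minor
  field
    ground : Subset n
    rank   : Subset n → ℕ

open Minor public

asMinor : ∀ {n} → Matroid n → Minor n
asMinor M = minor ⊤ (Matroid.rk M)

rkM : ∀ {n} → Matroid n → ℕ
rkM M = Matroid.rk M ⊤

IsLoop : ∀ {n} → Matroid n → Fin n → Set
IsLoop M a = Matroid.rk M ⁅ a ⁆ ≡ 0
  where open import Relation.Binary.PropositionalEquality using (_≡_)

IsColoop : ∀ {n} → Matroid n → Fin n → Set
IsColoop M a = Matroid.rk M (⊤ ∖ a) ≡ rkM M ∸ 1
  where open import Relation.Binary.PropositionalEquality using (_≡_)

deletion : ∀ {n} → Matroid n → Fin n → Minor n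
deletion M a = minor (⊤ ∖ a) (Matroid.rk M)

contraction : ∀ {n} → Matroid n → Fin n → Minor n
contraction M a = minor (⊤ ∖ a) (λ X → Matroid.rk M (X ∪ ⁅ a ⁆) ∸ Matroid.rk M ⁅ a ⁆)

restriction : ∀ {n} → Matroid n → Subset n → Minor n
restriction M S = minor S (Matroid.rk M)

subsetsOf : ∀ {n} → Subset n → List (Subset n)
subsetsOf []            = [] ∷ []
subsetsOf (outside ∷ E) = map (outside ∷_) (subsetsOf E)
subsetsOf (inside ∷ E)  = map (outside ∷_) (subsetsOf E) ++ map (inside ∷_) (subsetsOf E)

-- all chains S₁ ⊆ S₂ ⊆ ⋯ ⊆ Sₘ ⊆ E, as vectors (S₁ at index 0)
chains : ∀ {n} (m : ℕ) → Subset n → List (Vec (Subset n) m)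
chains zero    E = [] ∷ []
chains (suc m) E = concatMap (λ S → map (λ c → c ∷ʳ S) (chains m S)) (subsetsOf E)

-- Variables x₁,…,x_k, y₁,…,y_k are represented by x y : ℕ → Carrier
-- with x_i = x (i - 1) (0-based); only indices < k are used.

module ChainTutte {c ℓ} (R : CommutativeRing c ℓ) where
  open CommutativeRing R

  pow : Carrier → ℕ → Carrier
  pow z zero    = 1#
  pow z (suc e) = z * pow z e

  sumL : List Carrier → Carrier
  sumL = foldr _+_ 0#

  prodFin : (m : ℕ) → (Fin m → Carrier) → Carrier
  prodFin zero    f = 1#
  prodFin (suc m) f = f Fin.zero * prodFin m (λ i → f (Fin.suc i))
    where import Data.Fin as Fin

  prodℕ : ℕ → (ℕ → Carrier) → Carrier
  prodℕ zero    f = 1#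
  prodℕ (suc m) f = prodℕ m f * f m

  _−1 : Carrier → Carrier
  z −1 = z + (- 1#)

  T : (k : ℕ) → ∀ {n} → Minor n → (ℕ → Carrier) → (ℕ → Carrier) → Carrier
  T k N x y = sumL (map term (chains k (ground N)))
    where
      r = rank N
      term : Vec (Subset _) k → Carrier
      term c = prodFin k (λ i →
                 pow (x (toℕ i) −1) (r (ground N) ∸ r (lookup c i))
               * pow (y (toℕ i) −1) (∣ lookup c i ∣ ∸ r (lookup c i)))

  sTmid : ∀ {n} → Matroid n → Fin n → (k j : ℕ) → (ℕ → Carrier) → (ℕ → Carrier) → Carrier
  sTmid M a k j x y = go (k ∸ j)
    where
      rk = Matroid.rk M
      M/a = contraction M a
      rk/a = rank M/a
      rkM/a = rk/a (ground M/a)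
      go : (m : ℕ) → Carrier
      go zero    = 0#   -- not used: k - j ≥ 1 when 1 ≤ j ≤ k - 1
      go (suc m) = sumL (map term (chains (suc m) (⊤ ∖ a)))
        where
          term : Vec (Subset _) (suc m) → Carrier
          term c =
              T j (restriction M (head c)) x y
            * prodFin (suc m) (λ i →
                  pow (x (toℕ i ℕ.+ j) −1) (rkM/a ∸ rk/a (lookup c i))
                * pow (y (toℕ i ℕ.+ j) −1) (∣ lookup c i ∣ ∸ rk/a (lookup c i)))
            * prodℕ j (λ i → pow (x i −1) (rk ⊤ ∸ rk (head c)))

  sT : ∀ {n} → Matroid n → Fin n → (k j : ℕ) → (ℕ → Carrier) → (ℕ → Carrier) → Carrier
  sT M a k j x y with j ℕ.≟ 0
  ... | yes _ = T k (contraction M a) x y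
  ... | no  _ with j ℕ.≟ k
  ...   | yes _ = T k (deletion M a) x y
  ...   | no  _ = sTmid M a k j x y

  sumSplit : ∀ {n} → Matroid n → Fin n → (k : ℕ) → (ℕ → Carrier) → (ℕ → Carrier) → Carrier
  sumSplit M a k x y = sumL (map (λ j → sT M a k j x y) (upTo (suc k)))

{-# OPTIONS --safe #-}
-- Sort the chains S₁ ⊆ ⋯ ⊆ S_k ⊆ 𝒜 of M by the number j of sets avoiding a:
-- the j lowest sets avoid a and the k − j highest ones are of the form S ∪ a
-- with S ⊆ 𝒜 − a.  Since a is not a loop, rk(S ∪ a) = rk_{M/a}(S) + 1, so the
-- upper sets carry exactly the weights of the contraction M/a.  The lower part
-- is a chain of M|_{S₁} once the factor (x_i − 1)^{rk M − rk S₁} is split off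
-- from each of its weights.  For j = k the whole chain lies in 𝒜 − a, whose
-- rank is rk M because a is not a coloop, so it is a chain of M\a.
module Submission where

open import Defs
open import Data.Nat as ℕ using (ℕ; zero; suc; _∸_; _≤_; _<_; _≥_; s≤s; _≟_)
import Data.Nat.Properties as ℕₚ
open import Data.Fin using (Fin; toℕ; inject₁; fromℕ)
import Data.Fin as Fin
open import Data.Fin.Properties using (toℕ-inject₁; toℕ-fromℕ)
open import Data.Fin.Subset
  using (Subset; inside; outside; _∪_; _∩_; ∣_∣; ⁅_⁆; _⊆_; _∉_; ⊤; ⊥) renaming (_-_ to _∖_)
open import Data.Fin.Subset.Properties
  using (out⊆; in⊆in; ⊆-trans; ⊆⊤; q⊆p∪q; drop-not-there; ∪-identityʳ; p─⊥≡p; ∣⁅x⁆∣≡1)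
open import Data.Vec using (Vec; []; _∷_; _∷ʳ_; lookup; head; here; there)
open import Data.List using (List; []; _∷_; _++_; map; concatMap; upTo)
open import Data.List.Properties using (map-∘; applyUpTo-∷ʳ)
open import Data.List.Relation.Unary.All as All using (All; []; _∷_)
open import Data.List.Relation.Unary.All.Properties using (map⁺; ++⁺; applyUpTo⁺₁)
open import Data.Sum using (inj₁; inj₂)
open import Function using (id; _∘_)
open import Relation.Binary.PropositionalEquality as ≡ using (_≡_)
open import Relation.Nullary using (¬_; yes; no; contradiction)
open import Algebra.Bundles using (CommutativeRing)

[m∸n]+[n∸o]≡m∸o : ∀ {m n o} → o ≤ n → n ≤ m → (m ∸ n) ℕ.+ (n ∸ o) ≡ m ∸ o
[m∸n]+[n∸o]≡m∸o {m} {n} {o} o≤n n≤m =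
  ≡.trans (≡.sym (ℕₚ.+-∸-assoc (m ∸ n) o≤n)) (≡.cong (_∸ o) (ℕₚ.m∸n+n≡m n≤m))

[m∸1]∸[n∸1]≡m∸n : ∀ m {n} → 1 ≤ n → (m ∸ 1) ∸ (n ∸ 1) ≡ m ∸ n
[m∸1]∸[n∸1]≡m∸n m {suc n} _ = ℕₚ.∸-+-assoc m 1 n

m∸[n∸1]≡1+m∸n : ∀ m {n} → 1 ≤ n → m ∸ (n ∸ 1) ≡ suc m ∸ n
m∸[n∸1]≡1+m∸n m {suc n} _ = ≡.refl

subsetsOf-⊆ : ∀ {n} (E : Subset n) → All (_⊆ E) (subsetsOf E)
subsetsOf-⊆ []            = id ∷ []
subsetsOf-⊆ (outside ∷ E) = map⁺ (All.map out⊆ (subsetsOf-⊆ E))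
subsetsOf-⊆ (inside ∷ E)  =
  ++⁺ (map⁺ (All.map out⊆ (subsetsOf-⊆ E))) (map⁺ (All.map in⊆in (subsetsOf-⊆ E)))

x∉p∖x : ∀ {n} (p : Subset n) (x : Fin n) → x ∉ p ∖ x
x∉p∖x (_ ∷ p) Fin.zero    ()
x∉p∖x (_ ∷ p) (Fin.suc x) (there x∈p∖x) = x∉p∖x p x x∈p∖x

⊤∖x∪⁅x⁆≡⊤ : ∀ {n} (x : Fin n) → (⊤ ∖ x) ∪ ⁅ x ⁆ ≡ ⊤
⊤∖x∪⁅x⁆≡⊤ Fin.zero    = ≡.cong (inside ∷_) (≡.trans (∪-identityʳ _) (p─⊥≡p ⊤))
⊤∖x∪⁅x⁆≡⊤ (Fin.suc x) = ≡.cong (inside ∷_) (⊤∖x∪⁅x⁆≡⊤ x)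

∣p∪⁅x⁆∣≡1+∣p∣ : ∀ {n} {p : Subset n} {x : Fin n} → x ∉ p → ∣ p ∪ ⁅ x ⁆ ∣ ≡ suc ∣ p ∣
∣p∪⁅x⁆∣≡1+∣p∣ {p = outside ∷ p} {Fin.zero}  _   = ≡.cong (suc ∘ ∣_∣) (∪-identityʳ p)
∣p∪⁅x⁆∣≡1+∣p∣ {p = inside ∷ p}  {Fin.zero}  x∉p = contradiction here x∉p
∣p∪⁅x⁆∣≡1+∣p∣ {p = outside ∷ p} {Fin.suc x} x∉p = ∣p∪⁅x⁆∣≡1+∣p∣ (drop-not-there x∉p)
∣p∪⁅x⁆∣≡1+∣p∣ {p = inside ∷ p}  {Fin.suc x} x∉p = ≡.cong suc (∣p∪⁅x⁆∣≡1+∣p∣ (drop-not-there x∉p))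

module Sums {c ℓ} (R : CommutativeRing c ℓ) where
  open CommutativeRing R
  open ChainTutte R using (pow; sumL; prodFin)
  open import Relation.Binary.Reasoning.Setoid setoid
  open import Algebra.Properties.CommutativeSemigroup +-commutativeSemigroup
    using () renaming (interchange to +-interchange)

  sumOver : ∀ {A : Set} → List A → (A → Carrier) → Carrier
  sumOver xs f = sumL (map f xs)

  infix 5 sumOver
  syntax sumOver xs (λ x → e) = ∑[ x ∈ xs ] e

  sum-cong : ∀ {A : Set} {f g : A → Carrier} (xs : List A) → (∀ x → f x ≈ g x) → sumOver xs f ≈ sumOver xs g
  sum-cong []       f≈g = refl
  sum-cong (x ∷ xs) f≈g = +-cong (f≈g x) (sum-cong xs f≈g)

  sum-cong-All : ∀ {A : Set} {P : A → Set} {f g : A → Carrier} {xs : List A} →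
                 All P xs → (∀ {x} → P x → f x ≈ g x) → sumOver xs f ≈ sumOver xs g
  sum-cong-All []         f≈g = refl
  sum-cong-All (px ∷ pxs) f≈g = +-cong (f≈g px) (sum-cong-All pxs f≈g)

  sum-map : ∀ {A B : Set} (g : A → B) (f : B → Carrier) (xs : List A) → sumOver (map g xs) f ≈ sumOver xs (f ∘ g)
  sum-map g f xs = reflexive (≡.cong sumL (≡.sym (map-∘ xs)))

  sum-++ : ∀ {A : Set} (f : A → Carrier) (xs ys : List A) → sumOver (xs ++ ys) f ≈ sumOver xs f + sumOver ys f
  sum-++ f []       ys = sym (+-identityˡ _)
  sum-++ f (x ∷ xs) ys = trans (+-cong refl (sum-++ f xs ys)) (sym (+-assoc _ _ _))

  sum-concatMap : ∀ {A B : Set} (f : B → Carrier) (g : A → List B) (xs : List A) →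
                  sumOver (concatMap g xs) f ≈ ∑[ x ∈ xs ] sumOver (g x) f
  sum-concatMap f g []       = refl
  sum-concatMap f g (x ∷ xs) = trans (sum-++ f (g x) (concatMap g xs)) (+-cong refl (sum-concatMap f g xs))

  sum-*ʳ : ∀ {A : Set} (f : A → Carrier) (z : Carrier) (xs : List A) → ∑[ x ∈ xs ] f x * z ≈ sumOver xs f * z
  sum-*ʳ f z []       = sym (zeroˡ z)
  sum-*ʳ f z (x ∷ xs) = trans (+-cong refl (sum-*ʳ f z xs)) (sym (distribʳ z _ _))

  sum-+ : ∀ {A : Set} (f g : A → Carrier) (xs : List A) → ∑[ x ∈ xs ] (f x + g x) ≈ sumOver xs f + sumOver xs g
  sum-+ f g []       = sym (+-identityˡ _)
  sum-+ f g (x ∷ xs) = trans (+-cong refl (sum-+ f g xs)) (+-interchange _ _ _ _)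

  sum-0 : ∀ {A : Set} (xs : List A) → ∑[ x ∈ xs ] 0# ≈ 0#
  sum-0 []       = refl
  sum-0 (x ∷ xs) = trans (+-identityˡ _) (sum-0 xs)

  sum-comm : ∀ {A B : Set} (f : A → B → Carrier) (xs : List A) (ys : List B) →
             ∑[ x ∈ xs ] ∑[ y ∈ ys ] f x y ≈ ∑[ y ∈ ys ] ∑[ x ∈ xs ] f x y
  sum-comm f xs []       = sum-0 xs
  sum-comm f xs (y ∷ ys) = trans (sum-+ (λ x → f x y) (λ x → ∑[ y ∈ ys ] f x y) xs) (+-cong refl (sum-comm f xs ys))

  sum-upTo-suc : ∀ (f : ℕ → Carrier) n → sumOver (upTo (suc n)) f ≈ sumOver (upTo n) f + f n
  sum-upTo-suc f n = begin
    sumOver (upTo (suc n)) f          ≡⟨ ≡.cong (λ js → sumOver js f) (≡.sym (applyUpTo-∷ʳ id n)) ⟩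
    sumOver (upTo n ++ n ∷ []) f      ≈⟨ sum-++ f (upTo n) (n ∷ []) ⟩
    sumOver (upTo n) f + (f n + 0#)   ≈⟨ +-cong refl (+-identityʳ (f n)) ⟩
    sumOver (upTo n) f + f n          ∎

  pow-+ : ∀ z p q → pow z (p ℕ.+ q) ≈ pow z p * pow z q
  pow-+ z zero    q = sym (*-identityˡ _)
  pow-+ z (suc p) q = trans (*-cong refl (pow-+ z p q)) (sym (*-assoc _ _ _))

  prodFin-cong : ∀ m {f g : Fin m → Carrier} → (∀ i → f i ≈ g i) → prodFin m f ≈ prodFin m g
  prodFin-cong zero    f≈g = refl
  prodFin-cong (suc m) f≈g = *-cong (f≈g Fin.zero) (prodFin-cong m (f≈g ∘ Fin.suc))

  prodFin-last : ∀ m (f : Fin (suc m) → Carrier) → prodFin (suc m) f ≈ prodFin m (f ∘ inject₁) * f (fromℕ m)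
  prodFin-last zero    f = trans (*-identityʳ _) (sym (*-identityˡ _))
  prodFin-last (suc m) f = trans (*-cong refl (prodFin-last m (f ∘ Fin.suc))) (sym (*-assoc _ _ _))

module ChainSums {c ℓ} (R : CommutativeRing c ℓ) where
  open CommutativeRing R
  open ChainTutte R using (prodFin; prodℕ)
  open Sums R
  open import Relation.Binary.Reasoning.Setoid setoid
  open import Algebra.Properties.CommutativeSemigroup +-commutativeSemigroup
    using () renaming (interchange to +-interchange)
  open import Algebra.Properties.CommutativeSemigroup *-commutativeSemigroup
    using () renaming (interchange to *-interchange)

  one : ∀ {n} → Subset n → Carrier
  one _ = 1#

  chainSum : ∀ {n} → (Subset n → Carrier) → (ℕ → Subset n → Carrier) → ℕ → Subset n → Carrier
  chainSum b w zero    E = b E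
  chainSum b w (suc m) E = ∑[ S ∈ subsetsOf E ] chainSum b w m S * w m S

  bottomOr : ∀ {n m} → Subset n → Vec (Subset n) m → Subset n
  bottomOr E []      = E
  bottomOr E (S ∷ _) = S

  chainTerm : ∀ {n} → (Subset n → Carrier) → (ℕ → Subset n → Carrier) →
              ∀ m → Subset n → Vec (Subset n) m → Carrier
  chainTerm b w m E c = b (bottomOr E c) * prodFin m (λ i → w (toℕ i) (lookup c i))

  chainTerm-∷ʳ : ∀ {n} (b : Subset n → Carrier) (w : ℕ → Subset n → Carrier) m (E S : Subset n) c →
                 chainTerm b w (suc m) E (c ∷ʳ S) ≈ chainTerm b w m S c * w m S
  chainTerm-∷ʳ b w m E S c = begin
    b (bottomOr E (c ∷ʳ S)) * prodFin (suc m) (λ i → w (toℕ i) (lookup (c ∷ʳ S) i))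
      ≈⟨ *-cong (reflexive (≡.cong b (bottom-∷ʳ c))) (prodFin-last m (λ i → w (toℕ i) (lookup (c ∷ʳ S) i))) ⟩
    b (bottomOr S c) * (prodFin m (λ i → w (toℕ (inject₁ i)) (lookup (c ∷ʳ S) (inject₁ i)))
                        * w (toℕ (fromℕ m)) (lookup (c ∷ʳ S) (fromℕ m)))
      ≈⟨ *-cong refl (*-cong (prodFin-cong m (λ i → reflexive (≡.cong₂ w (toℕ-inject₁ i) (lookup-∷ʳ-inject₁ c i))))
                             (reflexive (≡.cong₂ w (toℕ-fromℕ m) (lookup-∷ʳ-last c)))) ⟩
    b (bottomOr S c) * (prodFin m (λ i → w (toℕ i) (lookup c i)) * w m S)
      ≈⟨ sym (*-assoc _ _ _) ⟩
    chainTerm b w m S c * w m S ∎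
    where
      bottom-∷ʳ : ∀ {k} (c : Vec (Subset _) k) → bottomOr E (c ∷ʳ S) ≡ bottomOr S c
      bottom-∷ʳ []      = ≡.refl
      bottom-∷ʳ (_ ∷ _) = ≡.refl
      lookup-∷ʳ-inject₁ : ∀ {k} (c : Vec (Subset _) k) i → lookup (c ∷ʳ S) (inject₁ i) ≡ lookup c i
      lookup-∷ʳ-inject₁ (_ ∷ _) Fin.zero    = ≡.refl
      lookup-∷ʳ-inject₁ (_ ∷ c) (Fin.suc i) = lookup-∷ʳ-inject₁ c i
      lookup-∷ʳ-last : ∀ {k} (c : Vec (Subset _) k) → lookup (c ∷ʳ S) (fromℕ k) ≡ S
      lookup-∷ʳ-last []      = ≡.refl
      lookup-∷ʳ-last (_ ∷ c) = lookup-∷ʳ-last c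

  sum-chains≈chainSum : ∀ {n} (b : Subset n → Carrier) (w : ℕ → Subset n → Carrier) m (E : Subset n) →
                        sumOver (chains m E) (chainTerm b w m E) ≈ chainSum b w m E
  sum-chains≈chainSum b w zero    E = trans (+-identityʳ _) (*-identityʳ _)
  sum-chains≈chainSum b w (suc m) E = begin
    sumOver (concatMap (λ S → map (_∷ʳ S) (chains m S)) (subsetsOf E)) (chainTerm b w (suc m) E)
      ≈⟨ sum-concatMap _ (λ S → map (_∷ʳ S) (chains m S)) (subsetsOf E) ⟩
    ∑[ S ∈ subsetsOf E ] sumOver (map (_∷ʳ S) (chains m S)) (chainTerm b w (suc m) E)
      ≈⟨ sum-cong (subsetsOf E) (λ S → sum-map (_∷ʳ S) _ (chains m S)) ⟩
    ∑[ S ∈ subsetsOf E ] ∑[ c ∈ chains m S ] chainTerm b w (suc m) E (c ∷ʳ S)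
      ≈⟨ sum-cong (subsetsOf E) (λ S → sum-cong (chains m S) (chainTerm-∷ʳ b w m E S)) ⟩
    ∑[ S ∈ subsetsOf E ] ∑[ c ∈ chains m S ] chainTerm b w m S c * w m S
      ≈⟨ sum-cong (subsetsOf E) (λ S → sum-*ʳ (chainTerm b w m S) (w m S) (chains m S)) ⟩
    ∑[ S ∈ subsetsOf E ] sumOver (chains m S) (chainTerm b w m S) * w m S
      ≈⟨ sum-cong (subsetsOf E) (λ S → *-cong (sum-chains≈chainSum b w m S) refl) ⟩
    chainSum b w (suc m) E ∎

  chainSum-cong : ∀ {n} {b₁ b₂ : Subset n → Carrier} {w₁ w₂ : ℕ → Subset n → Carrier} m {E : Subset n} →
                  (∀ {S} → S ⊆ E → b₁ S ≈ b₂ S) → (∀ i {S} → S ⊆ E → w₁ i S ≈ w₂ i S) →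
                  chainSum b₁ w₁ m E ≈ chainSum b₂ w₂ m E
  chainSum-cong zero    b₁≈b₂ w₁≈w₂ = b₁≈b₂ id
  chainSum-cong (suc m) b₁≈b₂ w₁≈w₂ = sum-cong-All (subsetsOf-⊆ _) λ S⊆E →
    *-cong (chainSum-cong m (λ T⊆S → b₁≈b₂ (⊆-trans T⊆S S⊆E)) (λ i T⊆S → w₁≈w₂ i (⊆-trans T⊆S S⊆E)))
           (w₁≈w₂ m S⊆E)

  chainSum-rescale : ∀ {n} {S : Subset n} (f : ℕ → Carrier) {v w : ℕ → Subset n → Carrier} →
                     (∀ i {U} → U ⊆ S → f i * v i U ≈ w i U) →
                     ∀ j {U} → U ⊆ S → chainSum one v j U * prodℕ j f ≈ chainSum one w j U
  chainSum-rescale f fv≈w zero    _   = *-identityˡ 1#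
  chainSum-rescale f {v} {w} fv≈w (suc j) {U} U⊆S = begin
    (∑[ V ∈ subsetsOf U ] chainSum one v j V * v j V) * (prodℕ j f * f j)
      ≈⟨ sym (sum-*ʳ _ _ (subsetsOf U)) ⟩
    ∑[ V ∈ subsetsOf U ] (chainSum one v j V * v j V) * (prodℕ j f * f j)
      ≈⟨ sum-cong-All (subsetsOf-⊆ U) (λ V⊆U → trans (*-interchange _ _ _ _)
           (*-cong (chainSum-rescale f fv≈w j (⊆-trans V⊆U U⊆S))
                   (trans (*-comm _ _) (fv≈w j (⊆-trans V⊆U U⊆S))))) ⟩
    chainSum one w (suc j) U ∎

  sum-subsetsOf-outside∷ : ∀ {n} (f : Subset (suc n) → Carrier) (E : Subset n) →
                           sumOver (subsetsOf (outside ∷ E)) f ≈ ∑[ S ∈ subsetsOf E ] f (outside ∷ S)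
  sum-subsetsOf-outside∷ f E = sum-map (outside ∷_) f (subsetsOf E)

  sum-subsetsOf-inside∷ : ∀ {n} (f : Subset (suc n) → Carrier) (E : Subset n) →
                          sumOver (subsetsOf (inside ∷ E)) f
                          ≈ (∑[ S ∈ subsetsOf E ] f (outside ∷ S)) + (∑[ S ∈ subsetsOf E ] f (inside ∷ S))
  sum-subsetsOf-inside∷ f E = trans (sum-++ f (map (outside ∷_) (subsetsOf E)) (map (inside ∷_) (subsetsOf E)))
                                    (+-cong (sum-subsetsOf-outside∷ f E) (sum-map (inside ∷_) f (subsetsOf E)))

  sum-subsetsOf-∪⁅x⁆ : ∀ {n} (f : Subset n → Carrier) {E : Subset n} {x : Fin n} → x ∉ E →
                       sumOver (subsetsOf (E ∪ ⁅ x ⁆)) f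
                       ≈ sumOver (subsetsOf E) f + (∑[ S ∈ subsetsOf E ] f (S ∪ ⁅ x ⁆))
  sum-subsetsOf-∪⁅x⁆ f {inside ∷ E}  {Fin.zero}  x∉E = contradiction here x∉E
  sum-subsetsOf-∪⁅x⁆ f {outside ∷ E} {Fin.zero}  _   = begin
    sumOver (subsetsOf (inside ∷ (E ∪ ⊥))) f
      ≡⟨ ≡.cong (λ T → sumOver (subsetsOf (inside ∷ T)) f) (∪-identityʳ E) ⟩
    sumOver (subsetsOf (inside ∷ E)) f
      ≈⟨ sum-subsetsOf-inside∷ f E ⟩
    (∑[ S ∈ subsetsOf E ] f (outside ∷ S)) + (∑[ S ∈ subsetsOf E ] f (inside ∷ S))
      ≈⟨ +-cong (sym (sum-subsetsOf-outside∷ f E))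
                (trans (sum-cong (subsetsOf E) (λ S → reflexive (≡.cong (f ∘ (inside ∷_)) (≡.sym (∪-identityʳ S)))))
                       (sym (sum-subsetsOf-outside∷ (λ S → f (S ∪ ⁅ Fin.zero ⁆)) E))) ⟩
    sumOver (subsetsOf (outside ∷ E)) f + (∑[ S ∈ subsetsOf (outside ∷ E) ] f (S ∪ ⁅ Fin.zero ⁆)) ∎
  sum-subsetsOf-∪⁅x⁆ f {outside ∷ E} {Fin.suc x} x∉E = begin
    sumOver (subsetsOf (outside ∷ (E ∪ ⁅ x ⁆))) f
      ≈⟨ sum-subsetsOf-outside∷ f (E ∪ ⁅ x ⁆) ⟩
    ∑[ S ∈ subsetsOf (E ∪ ⁅ x ⁆) ] f (outside ∷ S)
      ≈⟨ sum-subsetsOf-∪⁅x⁆ (f ∘ (outside ∷_)) (drop-not-there x∉E) ⟩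
    (∑[ S ∈ subsetsOf E ] f (outside ∷ S)) + (∑[ S ∈ subsetsOf E ] f (outside ∷ (S ∪ ⁅ x ⁆)))
      ≈⟨ sym (+-cong (sum-subsetsOf-outside∷ f E) (sum-subsetsOf-outside∷ (λ S → f (S ∪ ⁅ Fin.suc x ⁆)) E)) ⟩
    sumOver (subsetsOf (outside ∷ E)) f + (∑[ S ∈ subsetsOf (outside ∷ E) ] f (S ∪ ⁅ Fin.suc x ⁆)) ∎
  sum-subsetsOf-∪⁅x⁆ f {inside ∷ E}  {Fin.suc x} x∉E = begin
    sumOver (subsetsOf (inside ∷ (E ∪ ⁅ x ⁆))) f
      ≈⟨ sum-subsetsOf-inside∷ f (E ∪ ⁅ x ⁆) ⟩
    (∑[ S ∈ subsetsOf (E ∪ ⁅ x ⁆) ] f (outside ∷ S)) + (∑[ S ∈ subsetsOf (E ∪ ⁅ x ⁆) ] f (inside ∷ S))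
      ≈⟨ +-cong (sum-subsetsOf-∪⁅x⁆ (f ∘ (outside ∷_)) x∉E₀) (sum-subsetsOf-∪⁅x⁆ (f ∘ (inside ∷_)) x∉E₀) ⟩
    ((∑[ S ∈ sE ] f (outside ∷ S)) + (∑[ S ∈ sE ] f (outside ∷ (S ∪ ⁅ x ⁆))))
      + ((∑[ S ∈ sE ] f (inside ∷ S)) + (∑[ S ∈ sE ] f (inside ∷ (S ∪ ⁅ x ⁆))))
      ≈⟨ +-interchange _ _ _ _ ⟩
    ((∑[ S ∈ sE ] f (outside ∷ S)) + (∑[ S ∈ sE ] f (inside ∷ S)))
      + ((∑[ S ∈ sE ] f (outside ∷ (S ∪ ⁅ x ⁆))) + (∑[ S ∈ sE ] f (inside ∷ (S ∪ ⁅ x ⁆))))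
      ≈⟨ sym (+-cong (sum-subsetsOf-inside∷ f E) (sum-subsetsOf-inside∷ (λ S → f (S ∪ ⁅ Fin.suc x ⁆)) E)) ⟩
    sumOver (subsetsOf (inside ∷ E)) f + (∑[ S ∈ subsetsOf (inside ∷ E) ] f (S ∪ ⁅ Fin.suc x ⁆)) ∎
    where
      x∉E₀ = drop-not-there x∉E
      sE = subsetsOf E

  -- Chains whose j lowest sets avoid a and whose l highest sets are S ∪ a with S ⊆ E.
  splitChainSum : ∀ {n} → (ℕ → Subset n → Carrier) → Fin n → ℕ → ℕ → Subset n → Carrier
  splitChainSum w a j l = chainSum (chainSum one w j) (λ i S → w (i ℕ.+ j) (S ∪ ⁅ a ⁆)) l

  chainSum-split : ∀ {n} (w : ℕ → Subset n → Carrier) {a : Fin n} {E : Subset n} → a ∉ E → ∀ m →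
                   chainSum one w m (E ∪ ⁅ a ⁆) ≈ ∑[ j ∈ upTo (suc m) ] splitChainSum w a j (m ∸ j) E
  chainSum-split w a∉E zero = sym (+-identityʳ 1#)
  chainSum-split w {a} {E} a∉E (suc m) = begin
    chainSum one w (suc m) (E ∪ ⁅ a ⁆)
      ≈⟨ sum-subsetsOf-∪⁅x⁆ (λ S → chainSum one w m S * w m S) a∉E ⟩
    chainSum one w (suc m) E + (∑[ S ∈ sE ] chainSum one w m (S ∪ ⁅ a ⁆) * w m (S ∪ ⁅ a ⁆))
      ≈⟨ +-cong refl (sum-cong-All (subsetsOf-⊆ E) (λ S⊆E → *-cong (chainSum-split w (a∉E ∘ S⊆E) m) refl)) ⟩
    chainSum one w (suc m) E + (∑[ S ∈ sE ] (∑[ j ∈ js ] split j S) * w m (S ∪ ⁅ a ⁆))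
      ≈⟨ +-cong refl (sum-cong sE (λ S → sym (sum-*ʳ (λ j → split j S) (w m (S ∪ ⁅ a ⁆)) js))) ⟩
    chainSum one w (suc m) E + (∑[ S ∈ sE ] ∑[ j ∈ js ] split j S * w m (S ∪ ⁅ a ⁆))
      ≈⟨ +-cong refl (sum-comm (λ S j → split j S * w m (S ∪ ⁅ a ⁆)) sE js) ⟩
    chainSum one w (suc m) E + (∑[ j ∈ js ] ∑[ S ∈ sE ] split j S * w m (S ∪ ⁅ a ⁆))
      ≈⟨ +-cong refl (sum-cong-All (applyUpTo⁺₁ id (suc m) id) raise-top) ⟩
    chainSum one w (suc m) E + (∑[ j ∈ js ] splitChainSum w a j (suc m ∸ j) E)
      ≈⟨ +-comm _ _ ⟩
    (∑[ j ∈ js ] splitChainSum w a j (suc m ∸ j) E) + chainSum one w (suc m) E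
      ≡⟨ ≡.cong (λ l → (∑[ j ∈ js ] splitChainSum w a j (suc m ∸ j) E) + splitChainSum w a (suc m) l E)
                (≡.sym (ℕₚ.n∸n≡0 m)) ⟩
    (∑[ j ∈ js ] splitChainSum w a j (suc m ∸ j) E) + splitChainSum w a (suc m) (suc m ∸ suc m) E
      ≈⟨ sym (sum-upTo-suc (λ j → splitChainSum w a j (suc m ∸ j) E) (suc m)) ⟩
    ∑[ j ∈ upTo (suc (suc m)) ] splitChainSum w a j (suc m ∸ j) E ∎
    where
      sE = subsetsOf E
      js = upTo (suc m)
      split : ℕ → Subset _ → Carrier
      split j S = splitChainSum w a j (m ∸ j) S
      raise-top : ∀ {j} → j < suc m →
                  ∑[ S ∈ sE ] split j S * w m (S ∪ ⁅ a ⁆) ≈ splitChainSum w a j (suc m ∸ j) E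
      raise-top {j} (s≤s j≤m) = reflexive (≡.trans
        (≡.cong (λ i → ∑[ S ∈ sE ] split j S * w i (S ∪ ⁅ a ⁆)) (≡.sym (ℕₚ.m∸n+n≡m j≤m)))
        (≡.cong (λ l → splitChainSum w a j l E) (≡.sym (ℕₚ.+-∸-assoc 1 j≤m))))

module TutteChains {c ℓ} (R : CommutativeRing c ℓ) (x y : ℕ → CommutativeRing.Carrier R) where
  open CommutativeRing R
  open ChainTutte R
  open Sums R
  open ChainSums R

  tutteWeight : ∀ {n} → (Subset n → ℕ) → ℕ → ℕ → Subset n → Carrier
  tutteWeight r top i S = pow (x i −1) (top ∸ r S) * pow (y i −1) (∣ S ∣ ∸ r S)

  T≈chainSum : ∀ k {n} (N : Minor n) → T k N x y ≈ chainSum one (tutteWeight (rank N) (rank N (ground N))) k (ground N)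
  T≈chainSum k N = trans (sum-cong (chains k (ground N)) (λ _ → sym (*-identityˡ _)))
                         (sum-chains≈chainSum one (tutteWeight (rank N) (rank N (ground N))) k (ground N))

  tutteWeight-raise : ∀ {n} (r : Subset n → ℕ) {s t : ℕ} i {U : Subset n} → r U ≤ s → s ≤ t →
    pow (x i −1) (t ∸ s) * tutteWeight r s i U ≈ tutteWeight r t i U
  tutteWeight-raise r {s} {t} i {U} rU≤s s≤t =
    trans (sym (*-assoc _ _ _))
          (*-cong (trans (sym (pow-+ (x i −1) (t ∸ s) (s ∸ r U)))
                         (reflexive (≡.cong (pow (x i −1)) ([m∸n]+[n∸o]≡m∸o rU≤s s≤t))))
                  refl)

module _ {n} (M : Matroid n) where
  open Matroid M

  rk⁅x⁆≤1 : ∀ a → rk ⁅ a ⁆ ≤ 1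
  rk⁅x⁆≤1 a = ≡.subst (rk ⁅ a ⁆ ≤_) (∣⁅x⁆∣≡1 a) (rk-≤-card ⁅ a ⁆)

  nonloop⇒rk⁅x⁆≡1 : ∀ {a} → ¬ IsLoop M a → rk ⁅ a ⁆ ≡ 1
  nonloop⇒rk⁅x⁆≡1 {a} a-nonloop = ℕₚ.≤-antisym (rk⁅x⁆≤1 a) (ℕₚ.n≢0⇒n>0 a-nonloop)

  noncoloop⇒rk[⊤∖x]≡rkM : ∀ {a} → ¬ IsColoop M a → rk (⊤ ∖ a) ≡ rkM M
  noncoloop⇒rk[⊤∖x]≡rkM {a} a-noncoloop with ℕₚ.m≤n⇒m<n∨m≡n (rk-mono {⊤ ∖ a} ⊆⊤)
  ... | inj₂ rk[⊤∖a]≡rk⊤ = rk[⊤∖a]≡rk⊤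
  ... | inj₁ rk[⊤∖a]<rk⊤ =
    contradiction (≡.cong (_∸ 1) (≡.sym (ℕₚ.≤-antisym rk⊤≤1+rk[⊤∖a] rk[⊤∖a]<rk⊤))) a-noncoloop
    where
      open ℕₚ.≤-Reasoning
      rk⊤≤1+rk[⊤∖a] : rk ⊤ ≤ suc (rk (⊤ ∖ a))
      rk⊤≤1+rk[⊤∖a] = begin
        rk ⊤                                                ≡⟨ ≡.cong rk (≡.sym (⊤∖x∪⁅x⁆≡⊤ a)) ⟩
        rk ((⊤ ∖ a) ∪ ⁅ a ⁆)                                ≤⟨ ℕₚ.m≤m+n _ _ ⟩
        rk ((⊤ ∖ a) ∪ ⁅ a ⁆) ℕ.+ rk ((⊤ ∖ a) ∩ ⁅ a ⁆)       ≤⟨ rk-submod (⊤ ∖ a) ⁅ a ⁆ ⟩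
        rk (⊤ ∖ a) ℕ.+ rk ⁅ a ⁆                              ≤⟨ ℕₚ.+-monoʳ-≤ (rk (⊤ ∖ a)) (rk⁅x⁆≤1 a) ⟩
        rk (⊤ ∖ a) ℕ.+ 1                                     ≡⟨ ℕₚ.+-comm (rk (⊤ ∖ a)) 1 ⟩
        suc (rk (⊤ ∖ a))                                     ∎

module DeletionContraction {c ℓ} (R : CommutativeRing c ℓ) {n} (M : Matroid n) (a : Fin n)
                           (x y : ℕ → CommutativeRing.Carrier R) where
  open CommutativeRing R
  open ChainTutte R
  open Sums R
  open ChainSums R
  open TutteChains R x y
  open Matroid M using (rk; rk-mono)
  open import Relation.Binary.Reasoning.Setoid setoid
  open import Algebra.Properties.CommutativeSemigroup *-commutativeSemigroup using (xy∙z≈xz∙y)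

  E : Subset n
  E = ⊤ ∖ a

  w : ℕ → Subset n → Carrier
  w = tutteWeight rk (rk ⊤)

  rk/a : Subset n → ℕ
  rk/a = rank (contraction M a)

  ⊆E⇒a∉ : ∀ {S} → S ⊆ E → a ∉ S
  ⊆E⇒a∉ S⊆E = x∉p∖x ⊤ a ∘ S⊆E

  contraction-weight : ¬ IsLoop M a → ∀ i {S} → a ∉ S → tutteWeight rk/a (rk/a E) i S ≈ w i (S ∪ ⁅ a ⁆)
  contraction-weight a-nonloop i {S} a∉S =
    reflexive (≡.cong₂ (λ e f → pow (x i −1) e * pow (y i −1) f) x-exponent y-exponent)
    where
      rk⁅a⁆≡1 : rk ⁅ a ⁆ ≡ 1
      rk⁅a⁆≡1 = nonloop⇒rk⁅x⁆≡1 M a-nonloop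
      rk[S∪a]≥1 : 1 ≤ rk (S ∪ ⁅ a ⁆)
      rk[S∪a]≥1 = ≡.subst (_≤ rk (S ∪ ⁅ a ⁆)) rk⁅a⁆≡1 (rk-mono (q⊆p∪q S ⁅ a ⁆))
      x-exponent : (rk (E ∪ ⁅ a ⁆) ∸ rk ⁅ a ⁆) ∸ (rk (S ∪ ⁅ a ⁆) ∸ rk ⁅ a ⁆) ≡ rk ⊤ ∸ rk (S ∪ ⁅ a ⁆)
      x-exponent rewrite ⊤∖x∪⁅x⁆≡⊤ a | rk⁅a⁆≡1 = [m∸1]∸[n∸1]≡m∸n (rk ⊤) rk[S∪a]≥1
      y-exponent : ∣ S ∣ ∸ (rk (S ∪ ⁅ a ⁆) ∸ rk ⁅ a ⁆) ≡ ∣ S ∪ ⁅ a ⁆ ∣ ∸ rk (S ∪ ⁅ a ⁆)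
      y-exponent rewrite ∣p∪⁅x⁆∣≡1+∣p∣ a∉S | rk⁅a⁆≡1 = m∸[n∸1]≡1+m∸n ∣ S ∣ rk[S∪a]≥1

  T-contraction : ¬ IsLoop M a → ∀ k → T k (contraction M a) x y ≈ splitChainSum w a 0 k E
  T-contraction a-nonloop k = trans (T≈chainSum k (contraction M a)) (chainSum-cong k (λ _ → refl) λ i S⊆E →
    trans (contraction-weight a-nonloop i (⊆E⇒a∉ S⊆E))
          (reflexive (≡.cong (λ j → w j _) (≡.sym (ℕₚ.+-identityʳ i)))))

  T-deletion : ¬ IsColoop M a → ∀ k → T k (deletion M a) x y ≈ chainSum one w k E
  T-deletion a-noncoloop k = trans (T≈chainSum k (deletion M a))
    (reflexive (≡.cong (λ t → chainSum one (tutteWeight rk t) k E) (noncoloop⇒rk[⊤∖x]≡rkM M a-noncoloop)))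

  T-restriction-rescaled : ∀ j S →
    T j (restriction M S) x y * prodℕ j (λ i → pow (x i −1) (rk ⊤ ∸ rk S)) ≈ chainSum one w j S
  T-restriction-rescaled j S = trans (*-cong (T≈chainSum j (restriction M S)) refl)
    (chainSum-rescale _ (λ i U⊆S → tutteWeight-raise rk i (rk-mono U⊆S) (rk-mono ⊆⊤)) j id)

  sTmid-sum≈splitChainSum : ¬ IsLoop M a → ∀ j m →
    ∑[ c ∈ chains (suc m) E ] T j (restriction M (head c)) x y
                                 * prodFin (suc m) (λ i → tutteWeight rk/a (rk/a E) (toℕ i ℕ.+ j) (lookup c i))
                                 * prodℕ j (λ i → pow (x i −1) (rk ⊤ ∸ rk (head c)))
    ≈ splitChainSum w a j (suc m) E
  sTmid-sum≈splitChainSum a-nonloop j m = begin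
    _ ≈⟨ sum-cong (chains (suc m) E) (λ { (_ ∷ _) → xy∙z≈xz∙y _ _ _ }) ⟩
    sumOver (chains (suc m) E) (chainTerm b v (suc m) E)
      ≈⟨ sum-chains≈chainSum b v (suc m) E ⟩
    chainSum b v (suc m) E
      ≈⟨ chainSum-cong (suc m) (λ {S} _ → T-restriction-rescaled j S)
                               (λ i S⊆E → contraction-weight a-nonloop (i ℕ.+ j) (⊆E⇒a∉ S⊆E)) ⟩
    splitChainSum w a j (suc m) E ∎
    where
      b : Subset n → Carrier
      b S = T j (restriction M S) x y * prodℕ j (λ i → pow (x i −1) (rk ⊤ ∸ rk S))
      v : ℕ → Subset n → Carrier
      v i = tutteWeight rk/a (rk/a E) (i ℕ.+ j)

  sT≈splitChainSum : ¬ IsLoop M a → ¬ IsColoop M a →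
                     ∀ {k j} → j ≤ k → sT M a k j x y ≈ splitChainSum w a j (k ∸ j) E
  sT≈splitChainSum a-nonloop a-noncoloop {k} {j} j≤k with j ≟ 0
  ... | yes ≡.refl = T-contraction a-nonloop k
  ... | no j≢0 with j ≟ k
  ...   | yes ≡.refl = trans (T-deletion a-noncoloop j)
                               (reflexive (≡.cong (λ l → splitChainSum w a j l E) (≡.sym (ℕₚ.n∸n≡0 j))))
  ...   | no j≢k with k ∸ j in k∸j≡
  ...     | zero  = contradiction (ℕₚ.≤-antisym j≤k (ℕₚ.m∸n≡0⇒m≤n k∸j≡)) j≢k
  ...     | suc m = sTmid-sum≈splitChainSum a-nonloop j m

theorem3p11 : ∀ {c ℓ} (R : CommutativeRing c ℓ) {n : ℕ} (M : Matroid n) (k : ℕ) (a : Fin n)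
    → k ≥ 1 → ¬ IsLoop M a → ¬ IsColoop M a
    → (x y : ℕ → CommutativeRing.Carrier R)
    → CommutativeRing._≈_ R (ChainTutte.T R k (asMinor M) x y)
    (ChainTutte.sumSplit R M a k x y)
theorem3p11 R M k a _ a-nonloop a-noncoloop x y = begin
  T k (asMinor M) x y
    ≈⟨ T≈chainSum k (asMinor M) ⟩
  chainSum one w k ⊤
    ≡⟨ ≡.cong (chainSum one w k) (≡.sym (⊤∖x∪⁅x⁆≡⊤ a)) ⟩
  chainSum one w k (E ∪ ⁅ a ⁆)
    ≈⟨ chainSum-split w (x∉p∖x ⊤ a) k ⟩
  ∑[ j ∈ upTo (suc k) ] splitChainSum w a j (k ∸ j) E
    ≈⟨ sum-cong-All (applyUpTo⁺₁ id (suc k) id)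
                    (λ { (s≤s j≤k) → sym (sT≈splitChainSum a-nonloop a-noncoloop j≤k) }) ⟩
  sumSplit M a k x y ∎
  where
    open CommutativeRing R
    open ChainTutte R
    open Sums R
    open ChainSums R
    open TutteChains R x y
    open DeletionContraction R M a x y
    open import Relation.Binary.Reasoning.Setoid setoid
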